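{- Let $\mathcal A$ be a set of unlabeled ordered forests with $n$ vertices, and let $\mathcal F$ be the corresponding set of labeled ordered forests (all labelings by $[n]$ of members of $\mathcal A$). Then, for an indeterminate $\alpha$, \[\sum_{F\in\mathcal F}(1+\alpha)^{\mathrm{prop}\,F}=n!\sum_{F\in\mathcal A}\prod_{v\in V(F)}\left(1+\frac{\alpha}{h(v)}\right).\]
   Context: An ordered tree is a rooted tree in which the children of each vertex are linearly ordered; an ordered forest is a forest of ordered trees in which the trees are also linearly ordered. A labeled ordered forest has vertex set $[n]$. A vertex $w$ is a descendant of $v$ if $v$ lies on the path from the root to $w$; a proper descendant if moreover $w\ne v$. A vertex is proper if its label is less than the labels of all its proper descendants; $\mathrm{prop}\,F$ is the number of proper vertices. The hook length $h(v)$ is the number of descendants of $v$, including $v$. -}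

module Defs where

open import Data.Nat using (ℕ; zero; suc; _+_; _<ᵇ_; _!)
open import Data.Bool using (Bool; true; _∧_; if_then_else_)
open import Data.List using (List; []; _∷_; _++_; map; upTo; foldr)
open import Data.Integer using (+_)
open import Data.Rational using (ℚ; _/_; 0ℚ; 1ℚ) renaming (_+_ to _+ℚ_; _*_ to _*ℚ_)

data Tree : Set where
  node : List Tree → Tree

Forest : Set
Forest = List Tree

data LTree : Set where
  lnode : ℕ → List LTree → LTree

LForest : Set
LForest = List LTree

mutual
  sizeT : Tree → ℕ
  sizeT (node ts) = suc (sizeF ts)

  sizeF : Forest → ℕ
  sizeF []       = 0
  sizeF (t ∷ ts) = sizeT t + sizeF ts

mutual
  shapeT : LTree → Tree
  shapeT (lnode _ ts) = node (shapeF ts)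

  shapeF : LForest → Forest
  shapeF []       = []
  shapeF (t ∷ ts) = shapeT t ∷ shapeF ts

mutual
  labelsT : LTree → List ℕ
  labelsT (lnode a ts) = a ∷ labelsF ts

  labelsF : LForest → List ℕ
  labelsF []       = []
  labelsF (t ∷ ts) = labelsT t ++ labelsF ts

range : ℕ → List ℕ
range n = map suc (upTo n)

allLess : ℕ → List ℕ → Bool
allLess a []       = true
allLess a (x ∷ xs) = (a <ᵇ x) ∧ allLess a xs

-- prop F: number of vertices whose label is less than the labels of all
-- their proper descendants (the proper descendants of lnode a ts are exactly
-- the vertices of ts).
mutual
  propT : LTree → ℕ
  propT (lnode a ts) = (if allLess a (labelsF ts) then 1 else 0) + propF ts

  propF : LForest → ℕ
  propF []       = 0
  propF (t ∷ ts) = propT t + propF ts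

_^ℚ_ : ℚ → ℕ → ℚ
x ^ℚ zero  = 1ℚ
x ^ℚ suc k = x *ℚ (x ^ℚ k)

sumℚ : List ℚ → ℚ
sumℚ = foldr _+ℚ_ 0ℚ

natℚ : ℕ → ℚ
natℚ k = (+ k) / 1

-- ∏_{v ∈ V(F)} (1 + α / h(v)), where h(v) = number of descendants of v
-- including v, i.e. h(node ts) = suc (sizeF ts).
mutual
  hookProdT : ℚ → Tree → ℚ
  hookProdT α (node ts) = (1ℚ +ℚ (α *ℚ ((+ 1) / suc (sizeF ts)))) *ℚ hookProdF α ts

  hookProdF : ℚ → Forest → ℚ
  hookProdF α []       = 1ℚ
  hookProdF α (t ∷ ts) = hookProdT α t *ℚ hookProdF α ts

{-# OPTIONS --safe #-}
-- It suffices to fix one shape A with n vertices and an n-element label set S and to show, by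
-- induction on A, that the labelings F of A by S satisfy  ∑ (1+α)^prop F = n! ∏_v (1 + α/h(v)).
-- For a forest t ∷ ts, a labeling is a choice of the k = |t| labels T of t, one of C(n,k), together
-- with labelings of t by T and of ts by S ∖ T; the weight is multiplicative and C(n,k) k! (n-k)! = n!.
-- For a tree, a labeling is a root label a with a labeling of the children by S ∖ {a}; the root is
-- proper exactly when a = min S, so it contributes the factor (1+α) + (n-1) = n (1 + α/h(root)).
-- Listing S increasingly makes min S its head.  The given list of labeled forests and the
-- concatenation of these enumerations over 𝒜 are duplicate-free with the same members, hence
-- permutations of each other.
module Submission where

open import Defs
open import Data.Nat using (ℕ; _!)
open import Data.Product using (_×_)
open import Data.List using (List; map)
open import Data.List.Membership.Propositional using (_∈_)
open import Data.List.Relation.Unary.All using (All)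
open import Data.List.Relation.Unary.Unique.Propositional using (Unique)
open import Data.List.Relation.Binary.Permutation.Propositional using (_↭_)
open import Data.Rational using (ℚ; 1ℚ) renaming (_+_ to _+ℚ_; _*_ to _*ℚ_)
open import Relation.Binary.PropositionalEquality using (_≡_)
open import Function.Bundles using (_⇔_)

open import Algebra.Bundles using (CommutativeRing; CommutativeMonoid)
open import Data.Bool using (true; false; _∧_; T)
open import Data.Bool.Properties using (T-≡; ∧-zeroʳ)
open import Data.Integer using (+_)
open import Data.List using ([]; _∷_; [_]; _++_; length; concatMap; cartesianProductWith; upTo)
open import Data.List.Properties
  using (map-∘; map-cong-local; length-map; length-++; length-upTo; ∷-injective)
open import Data.List.Membership.Propositional using (find; lose)
open import Data.List.Membership.Propositional.Properties
  using (∈-map⁺; ∈-map⁻; ∈-++⁺ˡ; ∈-++⁺ʳ; ∈-++⁻; ∈-∃++; ∈-concatMap⁺; ∈-concatMap⁻;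
         ∈-cartesianProductWith⁺; ∈-cartesianProductWith⁻)
open import Data.List.Membership.Propositional.Properties.WithK using (unique∧set⇒bag)
open import Data.List.Relation.Binary.BagAndSetEquality using (∼bag⇒↭)
open import Data.List.Relation.Binary.Disjoint.Propositional using (Disjoint)
open import Data.List.Relation.Binary.Permutation.Propositional
  using (↭-refl; ↭-sym; ↭-trans; ↭-prep; ↭-swap; ↭⇒↭ₛ)
open import Data.List.Relation.Binary.Permutation.Propositional.Properties
  using (All-resp-↭; ∈-resp-↭; drop-∷; drop-mid; shift; ↭-empty-inv; ↭-length)
  renaming (map⁺ to ↭-map⁺; ++⁺ to ↭-++⁺; ++⁺ˡ to ↭-++⁺ˡ; ++⁺ʳ to ↭-++⁺ʳ)
open import Data.List.Relation.Binary.Permutation.Setoid.Properties using (foldr-commMonoid)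
open import Data.List.Relation.Binary.Sublist.Propositional
  using (_⊆_; []; _∷_; _∷ʳ_; ⊆-refl; minimum; lookup)
open import Data.List.Relation.Binary.Sublist.Propositional.Properties using (All-resp-⊆)
open import Data.List.Relation.Unary.All as All using ([]; _∷_)
import Data.List.Relation.Unary.All.Properties as All
open import Data.List.Relation.Unary.AllPairs as AllPairs using (AllPairs; []; _∷_)
import Data.List.Relation.Unary.AllPairs.Properties as AllPairs
open import Data.List.Relation.Unary.Any using (here; there)
import Data.List.Relation.Unary.Unique.Propositional.Properties as Unique
open import Data.Nat using (zero; suc; _+_; _*_; _∸_; _≤_; _<_; _<ᵇ_; s<s)
open import Data.Nat.Combinatorics
  using (_C_; nCk≡n!/k![n-k]!; k![n∸k]!∣n!; nCk+nC[k+1]≡[n+1]C[k+1])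
open import Data.Nat.Coprimality using (1-coprimeTo) renaming (sym to coprime-sym)
open import Data.Nat.DivMod using (m/n*n≡m)
open import Data.Nat.Properties using (_!*_!≢0)
import Data.Nat.Properties as ℕ
open import Data.Product using (_,_; proj₁; proj₂; ∃-syntax; ∃₂; map₁; map₂)
open import Data.Rational using (mkℚ; _/_)
import Data.Rational.Properties as ℚ
open import Data.Rational.Solver using (module +-*-Solver)
open import Data.Sum using (inj₁; inj₂)
open import Function using (_∘_; id)
open import Function.Bundles using (Equivalence; mk⇔)
open import Relation.Nullary using (¬_; contradiction)
open import Relation.Binary.PropositionalEquality
  using (_≢_; refl; sym; trans; cong; cong₂; subst; setoid; module ≡-Reasoning)

open import Algebra.Properties.Semiring.Mult (CommutativeRing.semiring ℚ.+-*-commutativeRing)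
  using (×1-homo-*) renaming (_×_ to _×ℚ_)
open import Algebra.Properties.CommutativeSemigroup
  (CommutativeMonoid.commutativeSemigroup ℚ.*-1-commutativeMonoid) using (interchange)

open +-*-Solver
open ≡-Reasoning

natℚ≡mkℚ : ∀ k → natℚ k ≡ mkℚ (+ k) 0 (coprime-sym (1-coprimeTo k))
natℚ≡mkℚ k = ℚ.normalize-coprime (coprime-sym (1-coprimeTo k))

natℚ-suc : ∀ k → natℚ (suc k) ≡ 1ℚ +ℚ natℚ k
natℚ-suc zero    = refl
-- 1ℚ +ℚ mkℚ (+ m) 0 _ reduces to natℚ (suc (m * 1)).
natℚ-suc (suc k) = trans (cong (λ i → natℚ (suc (suc i))) (sym (ℕ.*-identityʳ k)))
                         (cong (1ℚ +ℚ_) (sym (natℚ≡mkℚ (suc k))))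

natℚ≡×1ℚ : ∀ k → natℚ k ≡ k ×ℚ 1ℚ
natℚ≡×1ℚ zero    = refl
natℚ≡×1ℚ (suc k) = trans (natℚ-suc k) (cong (1ℚ +ℚ_) (natℚ≡×1ℚ k))

natℚ-* : ∀ m n → natℚ (m * n) ≡ natℚ m *ℚ natℚ n
natℚ-* m n = begin
  natℚ (m * n)            ≡⟨ natℚ≡×1ℚ (m * n) ⟩
  (m * n) ×ℚ 1ℚ           ≡⟨ ×1-homo-* m n ⟩
  (m ×ℚ 1ℚ) *ℚ (n ×ℚ 1ℚ)  ≡⟨ sym (cong₂ _*ℚ_ (natℚ≡×1ℚ m) (natℚ≡×1ℚ n)) ⟩
  natℚ m *ℚ natℚ n        ∎

1/[1+m]*[1+m]≡1 : ∀ m → ((+ 1) / suc m) *ℚ natℚ (suc m) ≡ 1ℚ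
1/[1+m]*[1+m]≡1 m = trans
  (cong₂ _*ℚ_ (ℚ.normalize-coprime (1-coprimeTo (suc m))) (natℚ≡mkℚ (suc m)))
  (ℚ.*-inverseˡ (mkℚ (+ suc m) 0 (coprime-sym (1-coprimeTo (suc m)))))

^ℚ-distribˡ-+-*ℚ : ∀ x i j → x ^ℚ (i + j) ≡ x ^ℚ i *ℚ x ^ℚ j
^ℚ-distribˡ-+-*ℚ x zero    j = sym (ℚ.*-identityˡ _)
^ℚ-distribˡ-+-*ℚ x (suc i) j = trans (cong (x *ℚ_) (^ℚ-distribˡ-+-*ℚ x i j)) (sym (ℚ.*-assoc x _ _))

nCk*[k!*[n∸k]!]≡n! : ∀ {n k} → k ≤ n → (n C k) * (k ! * (n ∸ k) !) ≡ n !
nCk*[k!*[n∸k]!]≡n! {n} {k} k≤n = trans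
  (cong (_* (k ! * (n ∸ k) !)) (nCk≡n!/k![n-k]! k≤n))
  (m/n*n≡m {{k !* (n ∸ k) !≢0}} (k![n∸k]!∣n! k≤n))

hook-recurrence-node : ∀ α m H →
  (1ℚ +ℚ α) *ℚ (natℚ (m !) *ℚ H) +ℚ natℚ m *ℚ (natℚ (m !) *ℚ H)
    ≡ natℚ (suc m !) *ℚ ((1ℚ +ℚ α *ℚ ((+ 1) / suc m)) *ℚ H)
hook-recurrence-node α m H = begin
  (1ℚ +ℚ α) *ℚ K +ℚ natℚ m *ℚ K  ≡⟨ sym (ℚ.*-distribʳ-+ K (1ℚ +ℚ α) (natℚ m)) ⟩
  ((1ℚ +ℚ α) +ℚ natℚ m) *ℚ K     ≡⟨ cong (_*ℚ K) 1+α+m≡N*D ⟩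
  (N *ℚ D) *ℚ (natℚ (m !) *ℚ H)  ≡⟨ interchange N D (natℚ (m !)) H ⟩
  (N *ℚ natℚ (m !)) *ℚ (D *ℚ H)  ≡⟨ cong (_*ℚ (D *ℚ H)) (sym (natℚ-* (suc m) (m !))) ⟩
  natℚ (suc m !) *ℚ (D *ℚ H)     ∎
  where
  N = natℚ (suc m)
  I = (+ 1) / suc m
  D = 1ℚ +ℚ α *ℚ I
  K = natℚ (m !) *ℚ H
  1+α+m≡N*D : (1ℚ +ℚ α) +ℚ natℚ m ≡ N *ℚ D
  1+α+m≡N*D = begin
    (1ℚ +ℚ α) +ℚ natℚ m
      ≡⟨ solve 2 (λ a n → (con 1ℚ :+ a) :+ n := (con 1ℚ :+ n) :+ a :* con 1ℚ) refl α (natℚ m) ⟩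
    (1ℚ +ℚ natℚ m) +ℚ α *ℚ 1ℚ
      ≡⟨ cong₂ (λ u v → u +ℚ α *ℚ v) (sym (natℚ-suc m)) (sym (1/[1+m]*[1+m]≡1 m)) ⟩
    N +ℚ α *ℚ (I *ℚ N)
      ≡⟨ solve 3 (λ n a i → n :+ a :* (i :* n) := n :* (con 1ℚ :+ a :* i)) refl N α I ⟩
    N *ℚ D ∎

hook-recurrence-∷ : ∀ k j x y →
  natℚ ((k + j) C k) *ℚ ((natℚ (k !) *ℚ x) *ℚ (natℚ (j !) *ℚ y)) ≡ natℚ ((k + j) !) *ℚ (x *ℚ y)
hook-recurrence-∷ k j x y = begin
  B *ℚ ((natℚ (k !) *ℚ x) *ℚ (natℚ (j !) *ℚ y))  ≡⟨ cong (B *ℚ_) (interchange (natℚ (k !)) x (natℚ (j !)) y) ⟩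
  B *ℚ ((natℚ (k !) *ℚ natℚ (j !)) *ℚ (x *ℚ y))  ≡⟨ sym (ℚ.*-assoc B _ _) ⟩
  B *ℚ (natℚ (k !) *ℚ natℚ (j !)) *ℚ (x *ℚ y)    ≡⟨ cong (_*ℚ (x *ℚ y)) B*k!*j!≡[k+j]! ⟩
  natℚ ((k + j) !) *ℚ (x *ℚ y)                    ∎
  where
  B = natℚ ((k + j) C k)
  B*k!*j!≡[k+j]! : B *ℚ (natℚ (k !) *ℚ natℚ (j !)) ≡ natℚ ((k + j) !)
  B*k!*j!≡[k+j]! = begin
    B *ℚ (natℚ (k !) *ℚ natℚ (j !))
      ≡⟨ cong (B *ℚ_) (sym (natℚ-* (k !) (j !))) ⟩
    B *ℚ natℚ (k ! * j !)
      ≡⟨ sym (natℚ-* ((k + j) C k) (k ! * j !)) ⟩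
    natℚ (((k + j) C k) * (k ! * j !))
      ≡⟨ cong (λ i → natℚ (((k + j) C k) * (k ! * i !))) (sym (ℕ.m+n∸m≡n k j)) ⟩
    natℚ (((k + j) C k) * (k ! * (k + j ∸ k) !))
      ≡⟨ cong natℚ (nCk*[k!*[n∸k]!]≡n! (ℕ.m≤m+n k j)) ⟩
    natℚ ((k + j) !) ∎

module _ {A : Set} where

  ∑ : (A → ℚ) → List A → ℚ
  ∑ f xs = sumℚ (map f xs)

  ∑-++ : ∀ (f : A → ℚ) xs ys → ∑ f (xs ++ ys) ≡ ∑ f xs +ℚ ∑ f ys
  ∑-++ f []       ys = sym (ℚ.+-identityˡ _)
  ∑-++ f (x ∷ xs) ys = trans (cong (f x +ℚ_) (∑-++ f xs ys)) (sym (ℚ.+-assoc (f x) _ _))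

  ∑-cong : ∀ {f g : A → ℚ} {xs} → (∀ {x} → x ∈ xs → f x ≡ g x) → ∑ f xs ≡ ∑ g xs
  ∑-cong f≡g = cong sumℚ (map-cong-local (All.tabulate f≡g))

  ∑-*ˡ : ∀ c (f : A → ℚ) xs → ∑ (λ x → c *ℚ f x) xs ≡ c *ℚ ∑ f xs
  ∑-*ˡ c f []       = sym (ℚ.*-zeroʳ c)
  ∑-*ˡ c f (x ∷ xs) = trans (cong (c *ℚ f x +ℚ_) (∑-*ˡ c f xs)) (sym (ℚ.*-distribˡ-+ c (f x) _))

  ∑-const : ∀ c (xs : List A) → ∑ (λ _ → c) xs ≡ natℚ (length xs) *ℚ c
  ∑-const c []       = sym (ℚ.*-zeroˡ c)
  ∑-const c (x ∷ xs) = begin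
    c +ℚ ∑ (λ _ → c) xs
      ≡⟨ cong (c +ℚ_) (∑-const c xs) ⟩
    c +ℚ natℚ (length xs) *ℚ c
      ≡⟨ solve 2 (λ c n → c :+ n :* c := (con 1ℚ :+ n) :* c) refl c (natℚ (length xs)) ⟩
    (1ℚ +ℚ natℚ (length xs)) *ℚ c
      ≡⟨ cong (_*ℚ c) (sym (natℚ-suc (length xs))) ⟩
    natℚ (suc (length xs)) *ℚ c ∎

  ∑-↭ : ∀ (f : A → ℚ) {xs ys} → xs ↭ ys → ∑ f xs ≡ ∑ f ys
  ∑-↭ f xs↭ys = foldr-commMonoid (setoid ℚ) ℚ.+-0-isCommutativeMonoid (↭⇒↭ₛ (↭-map⁺ f xs↭ys))

module _ {A B : Set} where

  ∑-map : ∀ (f : B → ℚ) (g : A → B) xs → ∑ f (map g xs) ≡ ∑ (f ∘ g) xs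
  ∑-map f g xs = cong sumℚ (sym (map-∘ xs))

  ∑-concatMap : ∀ (f : B → ℚ) (g : A → List B) xs → ∑ f (concatMap g xs) ≡ ∑ (∑ f ∘ g) xs
  ∑-concatMap f g []       = refl
  ∑-concatMap f g (x ∷ xs) = trans (∑-++ f (g x) _) (cong (∑ f (g x) +ℚ_) (∑-concatMap f g xs))

∑-cartesianProductWith : ∀ {A B C : Set} (f : A → B → C) {w : C → ℚ} {u : A → ℚ} {v : B → ℚ} →
  (∀ x y → w (f x y) ≡ u x *ℚ v y) →
  ∀ xs ys → ∑ w (cartesianProductWith f xs ys) ≡ ∑ u xs *ℚ ∑ v ys
∑-cartesianProductWith f {v = v} w≡uv [] ys = sym (ℚ.*-zeroˡ (∑ v ys))
∑-cartesianProductWith f {w} {u} {v} w≡uv (x ∷ xs) ys = begin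
  ∑ w (map (f x) ys ++ cartesianProductWith f xs ys)
    ≡⟨ ∑-++ w (map (f x) ys) _ ⟩
  ∑ w (map (f x) ys) +ℚ ∑ w (cartesianProductWith f xs ys)
    ≡⟨ cong₂ _+ℚ_ row (∑-cartesianProductWith f w≡uv xs ys) ⟩
  u x *ℚ ∑ v ys +ℚ ∑ u xs *ℚ ∑ v ys
    ≡⟨ sym (ℚ.*-distribʳ-+ (∑ v ys) (u x) _) ⟩
  (u x +ℚ ∑ u xs) *ℚ ∑ v ys ∎
  where
  row : ∑ w (map (f x) ys) ≡ u x *ℚ ∑ v ys
  row = trans (∑-map w (f x) ys) (trans (∑-cong {xs = ys} (λ {y} _ → w≡uv x y)) (∑-*ˡ (u x) v ys))

AllPairs-resp-⊆ : ∀ {A : Set} {R : A → A → Set} {xs ys} → xs ⊆ ys → AllPairs R ys → AllPairs R xs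
AllPairs-resp-⊆ []             []         = []
AllPairs-resp-⊆ (y ∷ʳ xs⊆ys)   (_ ∷ Rys)  = AllPairs-resp-⊆ xs⊆ys Rys
AllPairs-resp-⊆ (refl ∷ xs⊆ys) (Ry ∷ Rys) = All-resp-⊆ xs⊆ys Ry ∷ AllPairs-resp-⊆ xs⊆ys Rys

module _ {A : Set} where

  ∈⇒↭∷ : ∀ {x : A} {xs} → x ∈ xs → ∃[ ys ] xs ↭ x ∷ ys
  ∈⇒↭∷ x∈xs with ys , zs , refl ← ∈-∃++ x∈xs = ys ++ zs , shift _ ys zs

  picks : List A → List (A × List A)
  picks []       = []
  picks (x ∷ xs) = (x , xs) ∷ map (map₂ (x ∷_)) (picks xs)

  map-proj₁-picks : ∀ xs → map proj₁ (picks xs) ≡ xs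
  map-proj₁-picks []       = refl
  map-proj₁-picks (x ∷ xs) = cong (x ∷_) (trans (sym (map-∘ (picks xs))) (map-proj₁-picks xs))

  length-picks : ∀ xs → length (picks xs) ≡ length xs
  length-picks xs = trans (sym (length-map proj₁ (picks xs))) (cong length (map-proj₁-picks xs))

  picks-sound : ∀ {a R xs} → (a , R) ∈ picks xs → a ∷ R ↭ xs × R ⊆ xs
  picks-sound {xs = x ∷ xs} (here refl) = ↭-refl , x ∷ʳ ⊆-refl
  picks-sound {xs = x ∷ xs} (there aR∈)
    with (a , R) , aR∈′ , refl ← ∈-map⁻ (map₂ (x ∷_)) aR∈
    with a∷R↭xs , R⊆xs ← picks-sound aR∈′
    = ↭-trans (↭-swap a x ↭-refl) (↭-prep x a∷R↭xs) , refl ∷ R⊆xs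

  picks-++ : ∀ xs a ys → (a , xs ++ ys) ∈ picks (xs ++ a ∷ ys)
  picks-++ []       a ys = here refl
  picks-++ (x ∷ xs) a ys = there (∈-map⁺ (map₂ (x ∷_)) (picks-++ xs a ys))

  picks-complete : ∀ {a L xs} → a ∷ L ↭ xs → ∃[ R ] (a , R) ∈ picks xs × L ↭ R
  picks-complete a∷L↭xs with ys , zs , refl ← ∈-∃++ (∈-resp-↭ a∷L↭xs (here refl)) =
    ys ++ zs , picks-++ ys _ zs , drop-mid [] ys a∷L↭xs

  splits : ℕ → List A → List (List A × List A)
  splits zero    xs       = [ ([] , xs) ]
  splits (suc k) []       = []
  splits (suc k) (x ∷ xs) = map (map₁ (x ∷_)) (splits k xs) ++ map (map₂ (x ∷_)) (splits (suc k) xs)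

  length-splits : ∀ k xs → length (splits k xs) ≡ length xs C k
  length-splits zero    xs       = refl
  length-splits (suc k) []       = refl
  length-splits (suc k) (x ∷ xs) = begin
    length (map (map₁ (x ∷_)) (splits k xs) ++ map (map₂ (x ∷_)) (splits (suc k) xs))
      ≡⟨ length-++ (map (map₁ (x ∷_)) (splits k xs)) ⟩
    length (map (map₁ (x ∷_)) (splits k xs)) + length (map (map₂ (x ∷_)) (splits (suc k) xs))
      ≡⟨ cong₂ _+_ (trans (length-map _ (splits k xs)) (length-splits k xs))
                   (trans (length-map _ (splits (suc k) xs)) (length-splits (suc k) xs)) ⟩
    length xs C k + length xs C suc k
      ≡⟨ nCk+nC[k+1]≡[n+1]C[k+1] (length xs) k ⟩
    suc (length xs) C suc k ∎

  splits-sound : ∀ k {xs T U} → (T , U) ∈ splits k xs →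
                 length T ≡ k × T ++ U ↭ xs × T ⊆ xs × U ⊆ xs
  splits-sound zero (here refl) = refl , ↭-refl , minimum _ , ⊆-refl
  splits-sound (suc k) {x ∷ xs} TU∈ with ∈-++⁻ (map (map₁ (x ∷_)) (splits k xs)) TU∈
  ... | inj₁ TU∈ˡ
    with (T , U) , TU∈′ , refl ← ∈-map⁻ (map₁ (x ∷_)) TU∈ˡ
    with |T| , T++U↭xs , T⊆xs , U⊆xs ← splits-sound _ TU∈′
    = cong suc |T| , ↭-prep x T++U↭xs , refl ∷ T⊆xs , x ∷ʳ U⊆xs
  ... | inj₂ TU∈ʳ
    with (T , U) , TU∈′ , refl ← ∈-map⁻ (map₂ (x ∷_)) TU∈ʳ
    with |T| , T++U↭xs , T⊆xs , U⊆xs ← splits-sound _ TU∈′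
    = |T| , ↭-trans (shift x T U) (↭-prep x T++U↭xs) , x ∷ʳ T⊆xs , refl ∷ U⊆xs

  splits-complete : ∀ {k} X {Y xs} → length X ≡ k → X ++ Y ↭ xs →
                    ∃₂ λ T U → (T , U) ∈ splits k xs × X ↭ T × Y ↭ U
  splits-complete {zero} [] _ Y↭xs = [] , _ , here refl , ↭-refl , Y↭xs
  splits-complete {suc k} X {Y} {x ∷ xs} |X| X++Y↭ with ∈-++⁻ X (∈-resp-↭ (↭-sym X++Y↭) (here refl))
  ... | inj₁ x∈X
    with X′ , X↭x∷X′ ← ∈⇒↭∷ x∈X
    with T , U , TU∈ , X′↭T , Y↭U ← splits-complete X′
           (ℕ.suc-injective (trans (sym (↭-length X↭x∷X′)) |X|))
           (drop-∷ (↭-trans (↭-sym (↭-++⁺ʳ Y X↭x∷X′)) X++Y↭))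
    = x ∷ T , U , ∈-++⁺ˡ (∈-map⁺ (map₁ (x ∷_)) TU∈) , ↭-trans X↭x∷X′ (↭-prep x X′↭T) , Y↭U
  ... | inj₂ x∈Y
    with Y′ , Y↭x∷Y′ ← ∈⇒↭∷ x∈Y
    with T , U , TU∈ , X↭T , Y′↭U ← splits-complete X |X|
           (drop-∷ (↭-trans (↭-sym (↭-trans (↭-++⁺ˡ X Y↭x∷Y′) (shift x X Y′))) X++Y↭))
    = T , x ∷ U , ∈-++⁺ʳ _ (∈-map⁺ (map₂ (x ∷_)) TU∈) , X↭T , ↭-trans Y↭x∷Y′ (↭-prep x Y′↭U)
  splits-complete {suc k} []      {xs = []} () _
  splits-complete {suc k} (_ ∷ _) {xs = []} _  X++Y↭[] with () ← ↭-empty-inv X++Y↭[]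

  splits-proj₁-¬↭ : ∀ k {xs} → Unique xs → AllPairs (λ p q → ¬ (proj₁ p ↭ proj₁ q)) (splits k xs)
  splits-proj₁-¬↭ zero             _            = [] ∷ []
  splits-proj₁-¬↭ (suc k) {[]}     _            = []
  splits-proj₁-¬↭ (suc k) {x ∷ xs} (x∉xs ∷ xs!) =
    AllPairs.++⁺ (AllPairs.map⁺ (AllPairs.map (_∘ drop-∷) (splits-proj₁-¬↭ k xs!)))
                 (AllPairs.map⁺ (splits-proj₁-¬↭ (suc k) xs!))
                 (All.map⁺ (All.tabulate λ _ → All.map⁺ (All.tabulate λ q∈ → x∉second q∈)))
    where
    x∉second : ∀ {q} → q ∈ splits (suc k) xs → ∀ {T} → ¬ (x ∷ T ↭ proj₁ q)
    x∉second q∈ x∷T↭ with _ , _ , T′⊆xs , _ ← splits-sound (suc k) q∈ =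
      All.lookup x∉xs (lookup T′⊆xs (∈-resp-↭ x∷T↭ (here refl))) refl

mutual
  treeLabelings : Tree → List ℕ → List LTree
  treeLabelings (node cs) S = concatMap (λ (a , R) → map (lnode a) (forestLabelings cs R)) (picks S)

  forestLabelings : Forest → List ℕ → List LForest
  forestLabelings []       []      = [ [] ]
  forestLabelings []       (_ ∷ _) = []
  forestLabelings (t ∷ ts) S       =
    concatMap (λ (T , U) → cartesianProductWith _∷_ (treeLabelings t T) (forestLabelings ts U))
              (splits (sizeT t) S)

mutual
  length-labelsT : ∀ x → length (labelsT x) ≡ sizeT (shapeT x)
  length-labelsT (lnode a F) = cong suc (length-labelsF F)

  length-labelsF : ∀ F → length (labelsF F) ≡ sizeF (shapeF F)
  length-labelsF []      = refl
  length-labelsF (x ∷ F) = trans (length-++ (labelsT x)) (cong₂ _+_ (length-labelsT x) (length-labelsF F))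

mutual
  treeLabelings-sound : ∀ t {S x} → x ∈ treeLabelings t S → shapeT x ≡ t × labelsT x ↭ S
  treeLabelings-sound (node cs) {S} x∈
    with (a , R) , aR∈ , x∈′ ← find (∈-concatMap⁻ _ {xs = picks S} x∈)
    with F , F∈ , refl ← ∈-map⁻ (lnode a) x∈′
    with refl , F↭R ← forestLabelings-sound cs F∈
    = refl , ↭-trans (↭-prep a F↭R) (proj₁ (picks-sound aR∈))

  forestLabelings-sound : ∀ A {S F} → F ∈ forestLabelings A S → shapeF F ≡ A × labelsF F ↭ S
  forestLabelings-sound [] {[]} (here refl) = refl , ↭-refl
  forestLabelings-sound (t ∷ ts) {S} F∈
    with (T , U) , TU∈ , F∈′ ← find (∈-concatMap⁻ _ {xs = splits (sizeT t) S} F∈)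
    with x , G , x∈ , G∈ , refl ← ∈-cartesianProductWith⁻ _∷_ (treeLabelings t T) (forestLabelings ts U) F∈′
    with refl , x↭T ← treeLabelings-sound t x∈
    with refl , G↭U ← forestLabelings-sound ts G∈
    = refl , ↭-trans (↭-++⁺ x↭T G↭U) (proj₁ (proj₂ (splits-sound (sizeT t) TU∈)))

mutual
  treeLabelings-complete : ∀ x {S} → labelsT x ↭ S → x ∈ treeLabelings (shapeT x) S
  treeLabelings-complete (lnode a F) x↭S with R , aR∈ , F↭R ← picks-complete x↭S =
    ∈-concatMap⁺ _ (lose aR∈ (∈-map⁺ (lnode a) (forestLabelings-complete F F↭R)))

  forestLabelings-complete : ∀ F {S} → labelsF F ↭ S → F ∈ forestLabelings (shapeF F) S
  forestLabelings-complete []      []↭S with refl ← ↭-empty-inv (↭-sym []↭S) = here refl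
  forestLabelings-complete (x ∷ F) x∷F↭S
    with T , U , TU∈ , x↭T , F↭U ← splits-complete (labelsT x) (length-labelsT x) x∷F↭S
    = ∈-concatMap⁺ _ (lose TU∈ (∈-cartesianProductWith⁺ _∷_ (treeLabelings-complete x x↭T)
                                                             (forestLabelings-complete F F↭U)))

mutual
  treeLabelings-unique : ∀ t {S} → Unique S → Unique (treeLabelings t S)
  treeLabelings-unique (node cs) {S} S! =
    Unique.concat⁺ (All.map⁺ (All.tabulate rooted-unique))
                   (AllPairs.map⁺ (AllPairs.map distinct-roots (AllPairs.map⁻ picks!)))
    where
    picks! : Unique (map proj₁ (picks S))
    picks! = subst Unique (sym (map-proj₁-picks S)) S!
    rooted-unique : ∀ {p} → p ∈ picks S → Unique (map (lnode (proj₁ p)) (forestLabelings cs (proj₂ p)))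
    rooted-unique aR∈ = Unique.map⁺ (λ { refl → refl })
      (forestLabelings-unique cs (AllPairs-resp-⊆ (proj₂ (picks-sound aR∈)) S!))
    distinct-roots : ∀ {p q} → proj₁ p ≢ proj₁ q →
      Disjoint (map (lnode (proj₁ p)) (forestLabelings cs (proj₂ p)))
               (map (lnode (proj₁ q)) (forestLabelings cs (proj₂ q)))
    distinct-roots a≢b (x∈ , x∈′)
      with _ , _ , refl ← ∈-map⁻ _ x∈
      with _ , _ , refl ← ∈-map⁻ _ x∈′
      = a≢b refl

  forestLabelings-unique : ∀ A {S} → Unique S → Unique (forestLabelings A S)
  forestLabelings-unique []       {[]}    _  = [] ∷ []
  forestLabelings-unique []       {_ ∷ _} _  = []
  forestLabelings-unique (t ∷ ts) {S}     S! =
    Unique.concat⁺ (All.map⁺ (All.tabulate parts-unique))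
                   (AllPairs.map⁺ (AllPairs.map distinct-first (splits-proj₁-¬↭ (sizeT t) S!)))
    where
    parts : List ℕ × List ℕ → List LForest
    parts (T , U) = cartesianProductWith _∷_ (treeLabelings t T) (forestLabelings ts U)
    parts-unique : ∀ {p} → p ∈ splits (sizeT t) S → Unique (parts p)
    parts-unique TU∈ with _ , _ , T⊆S , U⊆S ← splits-sound (sizeT t) TU∈ =
      Unique.cartesianProductWith⁺ _∷_ ∷-injective
        (treeLabelings-unique t (AllPairs-resp-⊆ T⊆S S!)) (forestLabelings-unique ts (AllPairs-resp-⊆ U⊆S S!))
    distinct-first : ∀ {p q} → ¬ (proj₁ p ↭ proj₁ q) → Disjoint (parts p) (parts q)
    distinct-first {T , U} {T′ , U′} T≁T′ (F∈ , F∈′)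
      with _ , _ , x∈ , _ , refl ← ∈-cartesianProductWith⁻ _∷_ (treeLabelings t T) (forestLabelings ts U) F∈
      with _ , _ , x∈′ , _ , refl ← ∈-cartesianProductWith⁻ _∷_ (treeLabelings t T′) (forestLabelings ts U′) F∈′
      = T≁T′ (↭-trans (↭-sym (proj₂ (treeLabelings-sound t x∈))) (proj₂ (treeLabelings-sound t x∈′)))

≤⇒<ᵇ≡false : ∀ {m n} → n ≤ m → (m <ᵇ n) ≡ false
≤⇒<ᵇ≡false {m} {n} n≤m with m <ᵇ n in eq
... | false = refl
... | true  = contradiction (ℕ.<ᵇ⇒< m n (subst T (sym eq) _)) (ℕ.≤⇒≯ n≤m)

allLess-true : ∀ {a xs} → All (a <_) xs → allLess a xs ≡ true
allLess-true []           = refl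
allLess-true (a<x ∷ a<xs) = cong₂ _∧_ (Equivalence.to T-≡ (ℕ.<⇒<ᵇ a<x)) (allLess-true a<xs)

allLess-false : ∀ {a x xs} → x ∈ xs → x ≤ a → allLess a xs ≡ false
allLess-false {a} {xs = y ∷ ys} (here refl)  y≤a = cong (_∧ allLess a ys) (≤⇒<ᵇ≡false y≤a)
allLess-false {a} {xs = y ∷ ys} (there x∈ys) x≤a =
  trans (cong ((a <ᵇ y) ∧_) (allLess-false x∈ys x≤a)) (∧-zeroʳ (a <ᵇ y))

module _ (α : ℚ) where

  treeWeight : LTree → ℚ
  treeWeight x = (1ℚ +ℚ α) ^ℚ propT x

  forestWeight : LForest → ℚ
  forestWeight F = (1ℚ +ℚ α) ^ℚ propF F

  forestWeight-∷ : ∀ x F → forestWeight (x ∷ F) ≡ treeWeight x *ℚ forestWeight F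
  forestWeight-∷ x F = ^ℚ-distribˡ-+-*ℚ (1ℚ +ℚ α) (propT x) (propF F)

  treeWeight-minimal-root : ∀ {a} F → All (a <_) (labelsF F) →
                            treeWeight (lnode a F) ≡ (1ℚ +ℚ α) *ℚ forestWeight F
  treeWeight-minimal-root F a<F rewrite allLess-true a<F = refl

  treeWeight-nonminimal-root : ∀ {a x} F → x ∈ labelsF F → x ≤ a → treeWeight (lnode a F) ≡ forestWeight F
  treeWeight-nonminimal-root F x∈F x≤a rewrite allLess-false x∈F x≤a = refl

  ∑-minimal-root : ∀ {a} Fs → (∀ {F} → F ∈ Fs → All (a <_) (labelsF F)) →
                   ∑ treeWeight (map (lnode a) Fs) ≡ (1ℚ +ℚ α) *ℚ ∑ forestWeight Fs
  ∑-minimal-root {a} Fs a<Fs = begin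
    ∑ treeWeight (map (lnode a) Fs)           ≡⟨ ∑-map treeWeight (lnode a) Fs ⟩
    ∑ (treeWeight ∘ lnode a) Fs               ≡⟨ ∑-cong (λ {F} F∈ → treeWeight-minimal-root F (a<Fs F∈)) ⟩
    ∑ (λ F → (1ℚ +ℚ α) *ℚ forestWeight F) Fs  ≡⟨ ∑-*ˡ (1ℚ +ℚ α) forestWeight Fs ⟩
    (1ℚ +ℚ α) *ℚ ∑ forestWeight Fs            ∎

  ∑-nonminimal-root : ∀ {a x} Fs → (∀ {F} → F ∈ Fs → x ∈ labelsF F) → x ≤ a →
                      ∑ treeWeight (map (lnode a) Fs) ≡ ∑ forestWeight Fs
  ∑-nonminimal-root {a} Fs x∈Fs x≤a = trans
    (∑-map treeWeight (lnode a) Fs)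
    (∑-cong (λ {F} F∈ → treeWeight-nonminimal-root F (x∈Fs F∈) x≤a))

  mutual
    ∑-treeLabelings : ∀ t {S} → AllPairs _<_ S → length S ≡ sizeT t →
                      ∑ treeWeight (treeLabelings t S) ≡ natℚ (sizeT t !) *ℚ hookProdT α t
    ∑-treeLabelings (node cs) {x ∷ xs} (x<xs ∷ xs↑) |S| = begin
      ∑ treeWeight (rooted (x , xs) ++ concatMap rooted (map (map₂ (x ∷_)) (picks xs)))
        ≡⟨ ∑-++ treeWeight (rooted (x , xs)) _ ⟩
      ∑ treeWeight (rooted (x , xs)) +ℚ ∑ treeWeight (concatMap rooted (map (map₂ (x ∷_)) (picks xs)))
        ≡⟨ cong₂ _+ℚ_ minimal-root other-roots ⟩
      (1ℚ +ℚ α) *ℚ K +ℚ natℚ m *ℚ K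
        ≡⟨ hook-recurrence-node α m (hookProdF α cs) ⟩
      natℚ (suc m !) *ℚ hookProdT α (node cs) ∎
      where
      m = sizeF cs
      K = natℚ (m !) *ℚ hookProdF α cs
      rooted : ℕ × List ℕ → List LTree
      rooted (a , R) = map (lnode a) (forestLabelings cs R)
      |xs| : length xs ≡ m
      |xs| = ℕ.suc-injective |S|
      minimal-root : ∑ treeWeight (rooted (x , xs)) ≡ (1ℚ +ℚ α) *ℚ K
      minimal-root = trans
        (∑-minimal-root _ (λ F∈ → All-resp-↭ (↭-sym (proj₂ (forestLabelings-sound cs F∈))) x<xs))
        (cong ((1ℚ +ℚ α) *ℚ_) (∑-forestLabelings cs xs↑ |xs|))
      nonminimal-root : ∀ {p} → p ∈ picks xs → ∑ treeWeight (rooted (map₂ (x ∷_) p)) ≡ K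
      nonminimal-root {a , R} aR∈ with a∷R↭xs , R⊆xs ← picks-sound aR∈ = trans
        (∑-nonminimal-root _ (λ F∈ → ∈-resp-↭ (↭-sym (proj₂ (forestLabelings-sound cs F∈))) (here refl))
                             (ℕ.<⇒≤ (All.lookup x<xs (∈-resp-↭ a∷R↭xs (here refl)))))
        (∑-forestLabelings cs (All-resp-⊆ R⊆xs x<xs ∷ AllPairs-resp-⊆ R⊆xs xs↑)
                              (trans (↭-length a∷R↭xs) |xs|))
      other-roots : ∑ treeWeight (concatMap rooted (map (map₂ (x ∷_)) (picks xs))) ≡ natℚ m *ℚ K
      other-roots = begin
        ∑ treeWeight (concatMap rooted (map (map₂ (x ∷_)) (picks xs)))
          ≡⟨ ∑-concatMap treeWeight rooted (map (map₂ (x ∷_)) (picks xs)) ⟩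
        ∑ (∑ treeWeight ∘ rooted) (map (map₂ (x ∷_)) (picks xs))
          ≡⟨ ∑-map (∑ treeWeight ∘ rooted) (map₂ (x ∷_)) (picks xs) ⟩
        ∑ (∑ treeWeight ∘ rooted ∘ map₂ (x ∷_)) (picks xs)
          ≡⟨ ∑-cong nonminimal-root ⟩
        ∑ (λ _ → K) (picks xs)
          ≡⟨ ∑-const K (picks xs) ⟩
        natℚ (length (picks xs)) *ℚ K
          ≡⟨ cong (λ n → natℚ n *ℚ K) (trans (length-picks xs) |xs|) ⟩
        natℚ m *ℚ K ∎

    ∑-forestLabelings : ∀ A {S} → AllPairs _<_ S → length S ≡ sizeF A →
                        ∑ forestWeight (forestLabelings A S) ≡ natℚ (sizeF A !) *ℚ hookProdF α A
    ∑-forestLabelings []       {[]} [] refl = refl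
    ∑-forestLabelings (t ∷ ts) {S}  S↑ |S|  = begin
      ∑ forestWeight (concatMap parts (splits k S))
        ≡⟨ ∑-concatMap forestWeight parts (splits k S) ⟩
      ∑ (∑ forestWeight ∘ parts) (splits k S)
        ≡⟨ ∑-cong ∑-parts ⟩
      ∑ (λ _ → Kt *ℚ Kts) (splits k S)
        ≡⟨ ∑-const (Kt *ℚ Kts) (splits k S) ⟩
      natℚ (length (splits k S)) *ℚ (Kt *ℚ Kts)
        ≡⟨ cong (λ n → natℚ n *ℚ (Kt *ℚ Kts)) (trans (length-splits k S) (cong (_C k) |S|)) ⟩
      natℚ ((k + j) C k) *ℚ (Kt *ℚ Kts)
        ≡⟨ hook-recurrence-∷ k j (hookProdT α t) (hookProdF α ts) ⟩
      natℚ ((k + j) !) *ℚ hookProdF α (t ∷ ts) ∎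
      where
      k = sizeT t
      j = sizeF ts
      Kt = natℚ (k !) *ℚ hookProdT α t
      Kts = natℚ (j !) *ℚ hookProdF α ts
      parts : List ℕ × List ℕ → List LForest
      parts (T , U) = cartesianProductWith _∷_ (treeLabelings t T) (forestLabelings ts U)
      ∑-parts : ∀ {p} → p ∈ splits k S → ∑ forestWeight (parts p) ≡ Kt *ℚ Kts
      ∑-parts {T , U} TU∈ with |T| , T++U↭S , T⊆S , U⊆S ← splits-sound k TU∈ = begin
        ∑ forestWeight (parts (T , U))
          ≡⟨ ∑-cartesianProductWith _∷_ forestWeight-∷ (treeLabelings t T) (forestLabelings ts U) ⟩
        ∑ treeWeight (treeLabelings t T) *ℚ ∑ forestWeight (forestLabelings ts U)
          ≡⟨ cong₂ _*ℚ_ (∑-treeLabelings t (AllPairs-resp-⊆ T⊆S S↑) |T|)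
                        (∑-forestLabelings ts (AllPairs-resp-⊆ U⊆S S↑) |U|) ⟩
        Kt *ℚ Kts ∎
        where
        |U| : length U ≡ j
        |U| = ℕ.+-cancelˡ-≡ k (length U) j (begin
          k + length U          ≡⟨ cong (_+ length U) (sym |T|) ⟩
          length T + length U   ≡⟨ sym (length-++ T) ⟩
          length (T ++ U)       ≡⟨ ↭-length T++U↭S ⟩
          length S              ≡⟨ |S| ⟩
          k + j                 ∎)

labelings : List Forest → List ℕ → List LForest
labelings 𝒜 S = concatMap (λ A → forestLabelings A S) 𝒜

∈-labelings : ∀ {𝒜 S F} → F ∈ labelings 𝒜 S ⇔ (shapeF F ∈ 𝒜 × labelsF F ↭ S)
∈-labelings {𝒜} {S} {F} = mk⇔ to from
  where
  to : F ∈ labelings 𝒜 S → shapeF F ∈ 𝒜 × labelsF F ↭ S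
  to F∈ with A , A∈ , F∈′ ← find (∈-concatMap⁻ _ {xs = 𝒜} F∈)
        with refl , F↭S ← forestLabelings-sound A F∈′ = A∈ , F↭S
  from : shapeF F ∈ 𝒜 × labelsF F ↭ S → F ∈ labelings 𝒜 S
  from (A∈ , F↭S) = ∈-concatMap⁺ _ (lose A∈ (forestLabelings-complete F F↭S))

labelings-unique : ∀ {𝒜 S} → Unique 𝒜 → Unique S → Unique (labelings 𝒜 S)
labelings-unique {𝒜} {S} 𝒜! S! =
  Unique.concat⁺ (All.map⁺ (All.tabulate λ {A} _ → forestLabelings-unique A S!))
                 (AllPairs.map⁺ (AllPairs.map distinct-shapes 𝒜!))
  where
  distinct-shapes : ∀ {A B} → A ≢ B → Disjoint (forestLabelings A S) (forestLabelings B S)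
  distinct-shapes {A} {B} A≢B (F∈A , F∈B) =
    A≢B (trans (sym (proj₁ (forestLabelings-sound A F∈A))) (proj₁ (forestLabelings-sound B F∈B)))

range-increasing : ∀ n → AllPairs _<_ (range n)
range-increasing n = AllPairs.map⁺ (AllPairs.applyUpTo⁺₁ id n (λ i<j _ → s<s i<j))

length-range : ∀ n → length (range n) ≡ n
length-range n = trans (length-map suc (upTo n)) (length-upTo n)

lemma2p5 : (n : ℕ) (𝒜 : List Forest) (𝓕 : List LForest) →
    Unique 𝒜 → All (λ A → sizeF A ≡ n) 𝒜 →
    Unique 𝓕 →
    (∀ F → F ∈ 𝓕 ⇔ (shapeF F ∈ 𝒜 × labelsF F ↭ range n)) →
    (α : ℚ) →
    sumℚ (map (λ F → (1ℚ +ℚ α) ^ℚ propF F) 𝓕)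
      ≡ natℚ (n !) *ℚ sumℚ (map (hookProdF α) 𝒜)
lemma2p5 n 𝒜 𝓕 𝒜! |𝒜| 𝓕! 𝓕⇔ α = begin
  ∑ (forestWeight α) 𝓕
    ≡⟨ ∑-↭ (forestWeight α) 𝓕↭labelings ⟩
  ∑ (forestWeight α) (labelings 𝒜 (range n))
    ≡⟨ ∑-concatMap (forestWeight α) (λ A → forestLabelings A (range n)) 𝒜 ⟩
  ∑ (λ A → ∑ (forestWeight α) (forestLabelings A (range n))) 𝒜
    ≡⟨ ∑-cong shape-sum ⟩
  ∑ (λ A → natℚ (n !) *ℚ hookProdF α A) 𝒜
    ≡⟨ ∑-*ˡ (natℚ (n !)) (hookProdF α) 𝒜 ⟩
  natℚ (n !) *ℚ ∑ (hookProdF α) 𝒜 ∎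
  where
  𝓕↭labelings : 𝓕 ↭ labelings 𝒜 (range n)
  𝓕↭labelings = ∼bag⇒↭ (unique∧set⇒bag 𝓕! (labelings-unique 𝒜! (AllPairs.map ℕ.<⇒≢ (range-increasing n)))
    λ {F} → mk⇔ (Equivalence.from ∈-labelings ∘ Equivalence.to (𝓕⇔ F))
                (Equivalence.from (𝓕⇔ F) ∘ Equivalence.to ∈-labelings))
  shape-sum : ∀ {A} → A ∈ 𝒜 →
              ∑ (forestWeight α) (forestLabelings A (range n)) ≡ natℚ (n !) *ℚ hookProdF α A
  shape-sum {A} A∈ with refl ← All.lookup |𝒜| A∈ =
    ∑-forestLabelings α A (range-increasing n) (length-range (sizeF A))
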